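{- No logic splits the lattice $\mathsf{NExt}(L^*)$, where $L^*=\mathsf{K}_t\oplus(\Diamond\top\vee\mathsf{P}\top)$.
   Context: $\mathsf{K}_t$ is the least tense logic (future $\Box$, past possibility $\mathsf{P}$). A logic $L_1$ splits $\mathsf{NExt}(L_0)$ if there is $L_2$ such that for all $L\in\mathsf{NExt}(L_0)$ exactly one of $L\subseteq L_1$, $L\supseteq L_2$ holds. -}

module Defs where

open import Data.Nat using (ℕ)
open import Data.Product using (Σ; _×_)
open import Data.Sum using (_⊎_)
open import Relation.Nullary using (¬_)
open import Level using (0ℓ)

-- Tense formulas: propositional variables, ⊥, →, future box □ (G), past box ■ (H).
data Fm : Set where
  var  : ℕ → Fm
  ⊥'   : Fm
  _⇒_  : Fm → Fm → Fm
  □    : Fm → Fm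
  ■    : Fm → Fm

infixr 5 _⇒_

¬' : Fm → Fm
¬' φ = φ ⇒ ⊥'

⊤' : Fm
⊤' = ¬' ⊥'

_∨'_ : Fm → Fm → Fm
φ ∨' ψ = ¬' φ ⇒ ψ

◇ : Fm → Fm
◇ φ = ¬' (□ (¬' φ))

P : Fm → Fm
P φ = ¬' (■ (¬' φ))

sub : (ℕ → Fm) → Fm → Fm
sub σ (var n) = σ n
sub σ ⊥' = ⊥'
sub σ (φ ⇒ ψ) = sub σ φ ⇒ sub σ ψ
sub σ (□ φ) = □ (sub σ φ)
sub σ (■ φ) = ■ (sub σ φ)

Logic : Set₁
Logic = Fm → Set

_⊆_ : Logic → Logic → Set
L ⊆ M = ∀ φ → L φ → M φ

record NormalTense (L : Logic) : Set where
  field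
    ax1  : ∀ φ ψ → L (φ ⇒ ψ ⇒ φ)
    ax2  : ∀ φ ψ χ → L ((φ ⇒ ψ ⇒ χ) ⇒ (φ ⇒ ψ) ⇒ φ ⇒ χ)
    ax3  : ∀ φ → L (¬' (¬' φ) ⇒ φ)
    kG   : ∀ φ ψ → L (□ (φ ⇒ ψ) ⇒ □ φ ⇒ □ ψ)
    kH   : ∀ φ ψ → L (■ (φ ⇒ ψ) ⇒ ■ φ ⇒ ■ ψ)
    convG : ∀ φ → L (φ ⇒ □ (P φ))
    convH : ∀ φ → L (φ ⇒ ■ (◇ φ))
    mp   : ∀ φ ψ → L (φ ⇒ ψ) → L φ → L ψ
    necG : ∀ φ → L φ → L (□ φ)
    necH : ∀ φ → L φ → L (■ φ)
    us   : ∀ σ φ → L φ → L (sub σ φ)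

-- NExt(K_t ⊕ χ): normal tense logics containing the formula χ
-- (K_t ⊕ χ is the least such, so L ⊇ K_t ⊕ χ iff L is normal and χ ∈ L).
NExt⊕ : Fm → Logic → Set
NExt⊕ χ L = NormalTense L × L χ

χ* : Fm
χ* = ◇ ⊤' ∨' P ⊤'

Splits : Fm → Logic → Set₁
Splits χ L₁ =
  NExt⊕ χ L₁ ×
  Σ Logic (λ L₂ → NExt⊕ χ L₂ ×
    (∀ L → NExt⊕ χ L → ((L ⊆ L₁) ⊎ (L₂ ⊆ L)) × ¬ ((L ⊆ L₁) × (L₂ ⊆ L))))

module Submission where

-- Suppose L₁ splits NExt(L*) with companion L₂. We show L₂ ⊆ L₁, which contradicts the splitting
-- at L = L₂.
--
-- Normal extensions of L* arise from graphs whose edges are modal or plain. Fix a valuation that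
-- assigns a formula to each atom at each node. A formula is read at a node u by replacing □ψ with
-- the conjunction, over the future edges u → v, of □ψᵥ for a modal edge and of ψᵥ for a plain
-- one; ■ is treated dually with the past edges. The formulas whose reading is in L₁ at every
-- node, under every valuation, form a normal tense logic. It contains ◇⊤ ∨ P⊤ when every node
-- has a plain edge or edges in both directions, and it is only in the case of two modal edges
-- that ◇⊤ ∨ P⊤ ∈ L₁ is needed. If a node is surrounded by modal edges up to distance k, then
-- under the canonical valuation every formula of depth ≤ k reads there as a formula that is
-- L₁-equivalent to it. So every formula of depth ≤ k in such a logic is also in L₁.
--
-- For φ ∈ L₂ of depth d we use two graphs that have such a node. One is a directed path of
-- length 2d + 2 whose end edges are plain; the other is a ray with modal edges in both
-- directions and plain loops at 0 and from 2d on. Suppose neither logic contains L₂. Then both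
-- are contained in L₁. But π = (◇ ∨ P)ᵈ ◇²ᵈ⁺³ ⊤ is refuted on the path, since no forward walk
-- there is that long, and it holds on the ray, since every node is within d steps of a loop.
-- So L₁ is inconsistent.

open import Defs
open import Data.Empty using (⊥-elim)
open import Data.List using (List; []; _∷_)
open import Data.List.Membership.Propositional using (_∈_)
open import Data.List.Relation.Unary.Any using (here; there)
open import Data.Maybe using (Maybe; just; nothing)
open import Data.Nat using (ℕ; zero; suc; _+_; _⊔_; _≤_; _<_; z≤n; s≤s; s≤s⁻¹; _≤?_)
open import Data.Nat.Properties using (≤-refl; ≤-trans; <⇒≤; <⇒≱; ≤⇒≯; ≰⇒>; n≤1+n; m≤n⇒m≤1+n; m≤m+n; m≤n+m; m≤m⊔n; m≤n⊔m; m+n≤o⇒m≤o; m≤n⇒m<n∨m≡n; +-suc; +-identityʳ; +-monoˡ-≤)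
open import Data.Product using (∃-syntax; _×_; _,_; proj₁; proj₂)
open import Data.Sum using (_⊎_; inj₁; inj₂)
open import Data.Unit using (⊤; tt)
open import Function using (_∘_)
open import Relation.Nullary using (¬_; yes; no)
open import Relation.Binary.PropositionalEquality using (_≡_; _≗_; refl; sym; cong; cong₂; subst)

private variable
  X : Set
  a b c a′ b′ : Fm

_∧'_ : Fm → Fm → Fm
a ∧' b = ¬' (a ⇒ ¬' b)

⋀ : (X → Fm) → List X → Fm
⋀ f [] = ⊤'
⋀ f (x ∷ xs) = f x ∧' ⋀ f xs

⋀-cong : {f g : X → Fm} → f ≗ g → ∀ xs → ⋀ f xs ≡ ⋀ g xs
⋀-cong f≗g [] = refl
⋀-cong f≗g (x ∷ xs) = cong₂ _∧'_ (f≗g x) (⋀-cong f≗g xs)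

data Dir : Set where
  future past : Dir

opposite : Dir → Dir
opposite future = past
opposite past = future

box : Dir → Fm → Fm
box future = □
box past = ■

dia : Dir → Fm → Fm
dia d a = ¬' (box d (¬' a))

data Kind : Set where
  modal plain : Kind

infixr 6 □[_∣_]_

□[_∣_]_ : Dir → Kind → Fm → Fm
□[ d ∣ modal ] a = box d a
□[ d ∣ plain ] a = a

data Ctx : Set where
  ε : Ctx
  _▸_ : Ctx → Fm → Ctx

infixl 4 _▸_

_⇛_ : Ctx → Fm → Fm
ε ⇛ b = b
(Γ ▸ a) ⇛ b = Γ ⇛ (a ⇒ b)

private variable
  Γ : Ctx

module Hilbert {L : Logic} (NT : NormalTense L) where
  open NormalTense NT

  ⇒-refl : ∀ a → L (a ⇒ a)
  ⇒-refl a = mp _ _ (mp _ _ (ax2 a (a ⇒ a) a) (ax1 a (a ⇒ a))) (ax1 a a)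

  private
    ⇛-const : ∀ Γ → L b → L (Γ ⇛ b)
    ⇛-const ε h = h
    ⇛-const {b = b} (Γ ▸ a) h = ⇛-const Γ (mp _ _ (ax1 b a) h)

    ⇛-mp : ∀ Γ → L (Γ ⇛ (a ⇒ b)) → L (Γ ⇛ a) → L (Γ ⇛ b)
    ⇛-mp ε h₁ h₂ = mp _ _ h₁ h₂
    ⇛-mp {a = a} {b = b} (Γ ▸ c) h₁ h₂ = ⇛-mp Γ (⇛-mp Γ (⇛-const Γ (ax2 c a b)) h₁) h₂

  infix 2 _⊢_
  infixl 5 _·_
  infixr 4 ƛ_

  record _⊢_ (Γ : Ctx) (a : Fm) : Set where
    constructor ⟨_⟩
    field derivation : L (Γ ⇛ a)

  theorem : L a → Γ ⊢ a
  theorem {Γ = Γ} h = ⟨ ⇛-const Γ h ⟩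

  _·_ : Γ ⊢ a ⇒ b → Γ ⊢ a → Γ ⊢ b
  _·_ {Γ = Γ} ⟨ h₁ ⟩ ⟨ h₂ ⟩ = ⟨ ⇛-mp Γ h₁ h₂ ⟩

  ƛ_ : Γ ▸ a ⊢ b → Γ ⊢ a ⇒ b
  ƛ ⟨ h ⟩ = ⟨ h ⟩

  #0 : Γ ▸ a ⊢ a
  #0 {Γ = Γ} {a = a} = ⟨ ⇛-const Γ (⇒-refl a) ⟩

  weaken : Γ ⊢ b → Γ ▸ a ⊢ b
  weaken {Γ = Γ} {b = b} {a = a} ⟨ h ⟩ = ⟨ ⇛-mp Γ (⇛-const Γ (ax1 b a)) h ⟩

  #1 : Γ ▸ a ▸ b ⊢ a
  #1 = weaken #0

  closed : ε ⊢ a → L a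
  closed ⟨ h ⟩ = h

  entails : (∀ {Γ} → Γ ⊢ a → Γ ⊢ b) → L (a ⇒ b)
  entails f = closed (ƛ f #0)

  dne : Γ ⊢ ¬' (¬' a) → Γ ⊢ a
  dne {a = a} h = theorem (ax3 a) · h

  efq : Γ ⊢ ⊥' → Γ ⊢ a
  efq {a = a} h = dne (theorem (ax1 ⊥' (¬' a)) · h)

  ∧-intro : Γ ⊢ a → Γ ⊢ b → Γ ⊢ a ∧' b
  ∧-intro ha hb = ƛ #0 · weaken ha · weaken hb

  ∧-elimˡ : Γ ⊢ a ∧' b → Γ ⊢ a
  ∧-elimˡ h = dne (ƛ weaken h · (ƛ efq (#1 · #0)))

  ∧-elimʳ : Γ ⊢ a ∧' b → Γ ⊢ b
  ∧-elimʳ h = dne (ƛ weaken h · (ƛ #1))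

  ⋀-intro : {f : X → Fm} (xs : List X) → (∀ {x} → x ∈ xs → Γ ⊢ f x) → Γ ⊢ ⋀ f xs
  ⋀-intro [] h = ƛ #0
  ⋀-intro (x ∷ xs) h = ∧-intro (h (here refl)) (⋀-intro xs (h ∘ there))

  ⋀-elim : {f : X → Fm} {x : X} {xs : List X} → x ∈ xs → Γ ⊢ ⋀ f xs → Γ ⊢ f x
  ⋀-elim (here refl) h = ∧-elimˡ h
  ⋀-elim (there x∈xs) h = ⋀-elim x∈xs (∧-elimʳ h)

  ⇒-trans : L (a ⇒ b) → L (b ⇒ c) → L (a ⇒ c)
  ⇒-trans h₁ h₂ = entails (λ h → theorem h₂ · (theorem h₁ · h))

  contrapose : L (a ⇒ b) → L (¬' b ⇒ ¬' a)
  contrapose h = closed (ƛ ƛ #1 · (theorem h · #0))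

  explode : L (¬' a) → L a → L b
  explode h₁ h₂ = closed (efq (theorem h₁ · theorem h₂))

  ∨-introˡ : L a → L (a ∨' b)
  ∨-introˡ h = closed (ƛ efq (#0 · theorem h))

  ∨-introʳ : L b → L (a ∨' b)
  ∨-introʳ h = closed (ƛ theorem h)

  ∨-map : L (a ⇒ a′) → L (b ⇒ b′) → L (a ∨' b) → L (a′ ∨' b′)
  ∨-map f g h = closed (ƛ theorem g · (theorem h · (theorem (contrapose f) · #0)))

  ∨-refute : L (¬' a) → L (¬' b) → L (¬' (a ∨' b))
  ∨-refute h₁ h₂ = closed (ƛ theorem h₂ · (#0 · theorem h₁))

  infix 3 _⟺_

  _⟺_ : Fm → Fm → Set
  a ⟺ b = L (a ⇒ b) × L (b ⇒ a)

  ⇒-cong : a ⟺ a′ → b ⟺ b′ → (a ⇒ b) ⟺ (a′ ⇒ b′)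
  ⇒-cong (f , f⁻¹) (g , g⁻¹) =
    entails (λ h → ƛ theorem g · (weaken h · (theorem f⁻¹ · #0))) ,
    entails (λ h → ƛ theorem g⁻¹ · (weaken h · (theorem f · #0)))

  box-K : ∀ d a b → L (box d (a ⇒ b) ⇒ box d a ⇒ box d b)
  box-K future = kG
  box-K past = kH

  box-nec : ∀ d → L a → L (box d a)
  box-nec future = necG _
  box-nec past = necH _

  box-converse : ∀ d a → L (a ⇒ box d (dia (opposite d) a))
  box-converse future = convG
  box-converse past = convH

  □[]-nec : ∀ d κ → L a → L (□[ d ∣ κ ] a)
  □[]-nec d modal = box-nec d
  □[]-nec d plain h = h

  □[]-K : ∀ d κ → Γ ⊢ □[ d ∣ κ ] (a ⇒ b) → Γ ⊢ □[ d ∣ κ ] a → Γ ⊢ □[ d ∣ κ ] b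
  □[]-K {a = a} {b = b} d modal h₁ h₂ = theorem (box-K d a b) · h₁ · h₂
  □[]-K d plain h₁ h₂ = h₁ · h₂

  □[]-mono : ∀ d κ → L (a ⇒ b) → L (□[ d ∣ κ ] a ⇒ □[ d ∣ κ ] b)
  □[]-mono d κ h = entails (□[]-K d κ (theorem (□[]-nec d κ h)))

  □[]-converse : ∀ d κ a → L (a ⇒ □[ d ∣ κ ] ¬' (□[ opposite d ∣ κ ] ¬' a))
  □[]-converse d modal a = box-converse d a
  □[]-converse d plain a = closed (ƛ ƛ #0 · #1)

-- Graphs with modal and plain edges, and their logics

Edge : Set
Edge = ℕ × Kind

data χ*-Condition (edges : Dir → ℕ → List Edge) (u : ℕ) : Set where
  plain-edge : ∀ d {v} → (v , plain) ∈ edges d u → χ*-Condition edges u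
  two-sided : ∀ {v w κ κ′} → (v , κ) ∈ edges future u → (w , κ′) ∈ edges past u →
              χ*-Condition edges u

record Graph : Set₁ where
  field
    Node : ℕ → Set
    edges : Dir → ℕ → List Edge
    edge-target : ∀ {d u v κ} → (v , κ) ∈ edges d u → Node v
    edge-reverse : ∀ {d u v κ} → (v , κ) ∈ edges d u → (u , κ) ∈ edges (opposite d) v
    χ*-condition : ∀ {u} → Node u → χ*-Condition edges u

depth : Fm → ℕ
depth (var n) = 0
depth ⊥' = 0
depth (a ⇒ b) = depth a ⊔ depth b
depth (□ a) = suc (depth a)
depth (■ a) = suc (depth a)

◇ⁿ : ℕ → Fm → Fm
◇ⁿ zero a = a
◇ⁿ (suc m) a = ◇ (◇ⁿ m a)

⟐ : Fm → Fm
⟐ a = ◇ a ∨' P a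

⟐ⁿ : ℕ → Fm → Fm
⟐ⁿ zero a = a
⟐ⁿ (suc k) a = ⟐ (⟐ⁿ k a)

π : ℕ → ℕ → Fm
π k m = ⟐ⁿ k (◇ⁿ m ⊤')

module GraphLogic (G : Graph) where
  open Graph G

  boxAt : Dir → ℕ → (ℕ → Fm) → Fm
  boxAt d u f = ⋀ (λ (v , κ) → □[ d ∣ κ ] f v) (edges d u)

  diaAt : Dir → ℕ → (ℕ → Fm) → Fm
  diaAt d u f = ¬' (boxAt d u (λ v → ¬' (f v)))

  tr : (ℕ → ℕ → Fm) → ℕ → Fm → Fm
  tr σ u (var n) = σ n u
  tr σ u ⊥' = ⊥'
  tr σ u (a ⇒ b) = tr σ u a ⇒ tr σ u b
  tr σ u (□ a) = boxAt future u (λ v → tr σ v a)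
  tr σ u (■ a) = boxAt past u (λ v → tr σ v a)

  boxAt-cong : ∀ d u {f g : ℕ → Fm} → f ≗ g → boxAt d u f ≡ boxAt d u g
  boxAt-cong d u f≗g = ⋀-cong (λ (v , κ) → cong □[ d ∣ κ ]_ (f≗g v)) (edges d u)

  tr-sub : ∀ σ τ u φ → tr σ u (sub τ φ) ≡ tr (λ n v → tr σ v (τ n)) u φ
  tr-sub σ τ u (var n) = refl
  tr-sub σ τ u ⊥' = refl
  tr-sub σ τ u (a ⇒ b) = cong₂ _⇒_ (tr-sub σ τ u a) (tr-sub σ τ u b)
  tr-sub σ τ u (□ a) = boxAt-cong future u (λ v → tr-sub σ τ v a)
  tr-sub σ τ u (■ a) = boxAt-cong past u (λ v → tr-sub σ τ v a)

  Log : Logic → Logic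
  Log L φ = ∀ σ u → Node u → L (tr σ u φ)

  Faithful : ℕ → ℕ → Set
  Faithful zero u = ⊤
  Faithful (suc k) u = ∀ d →
    (∃[ v ] (v , modal) ∈ edges d u) × (∀ {v κ} → (v , κ) ∈ edges d u → κ ≡ modal × Faithful k v)

  canonical : ℕ → ℕ → Fm
  canonical n _ = var n

  module _ {L : Logic} (NT : NormalTense L) where
    open NormalTense NT
    open Hilbert NT

    boxAt-K : ∀ d u (f g : ℕ → Fm) →
              L (boxAt d u (λ v → f v ⇒ g v) ⇒ boxAt d u f ⇒ boxAt d u g)
    boxAt-K d u f g =
      closed (ƛ ƛ ⋀-intro (edges d u) (λ {(_ , κ)} e → □[]-K d κ (⋀-elim e #1) (⋀-elim e #0)))

    boxAt-nec : ∀ d u {f} → (∀ {v κ} → (v , κ) ∈ edges d u → L (f v)) → L (boxAt d u f)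
    boxAt-nec d u h = closed (⋀-intro (edges d u) (λ {(_ , κ)} e → theorem (□[]-nec d κ (h e))))

    boxAt-converse : ∀ d u (f : ℕ → Fm) → L (f u ⇒ boxAt d u (λ v → diaAt (opposite d) v f))
    boxAt-converse d u f = entails (λ h → ⋀-intro (edges d u) (λ e → theorem (converse e) · h))
      where
      converse : ∀ {v κ} → (v , κ) ∈ edges d u → L (f u ⇒ □[ d ∣ κ ] diaAt (opposite d) v f)
      converse {κ = κ} e = ⇒-trans (□[]-converse d κ (f u))
        (□[]-mono d κ (contrapose (entails (⋀-elim (edge-reverse e)))))

    Log-normal : NormalTense (Log L)
    Log-normal = record
      { ax1 = λ φ ψ σ u _ → ax1 _ _
      ; ax2 = λ φ ψ χ σ u _ → ax2 _ _ _
      ; ax3 = λ φ σ u _ → ax3 _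
      ; kG = λ φ ψ σ u _ → boxAt-K future u (λ v → tr σ v φ) (λ v → tr σ v ψ)
      ; kH = λ φ ψ σ u _ → boxAt-K past u (λ v → tr σ v φ) (λ v → tr σ v ψ)
      ; convG = λ φ σ u _ → boxAt-converse future u (λ v → tr σ v φ)
      ; convH = λ φ σ u _ → boxAt-converse past u (λ v → tr σ v φ)
      ; mp = λ φ ψ h₁ h₂ σ u u∈G → mp _ _ (h₁ σ u u∈G) (h₂ σ u u∈G)
      ; necG = λ φ h σ u _ → boxAt-nec future u (λ e → h σ _ (edge-target e))
      ; necH = λ φ h σ u _ → boxAt-nec past u (λ e → h σ _ (edge-target e))
      ; us = λ τ φ h σ u u∈G → subst L (sym (tr-sub σ τ u φ)) (h _ u u∈G)
      }

    diaAt-plain : ∀ d {u v f} → (v , plain) ∈ edges d u → L (f v) → L (diaAt d u f)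
    diaAt-plain d e h = closed (ƛ ⋀-elim e #0 · theorem h)

    diaAt-modal : ∀ d {u v f} → (v , modal) ∈ edges d u → L (f v) → L (dia d ⊤' ⇒ diaAt d u f)
    diaAt-modal d e h = contrapose
      (⇒-trans (entails (⋀-elim e)) (□[]-mono d modal (contrapose (closed (ƛ theorem h)))))

    diaAt-refute : ∀ d u {f} → (∀ {v κ} → (v , κ) ∈ edges d u → L (¬' (f v))) →
                   L (¬' (diaAt d u f))
    diaAt-refute d u h = closed (ƛ #0 · theorem (boxAt-nec d u h))

    ⟐-plain : ∀ d σ ψ u {v} → (v , plain) ∈ edges d u → L (tr σ v ψ) → L (tr σ u (⟐ ψ))
    ⟐-plain future σ ψ u e h = ∨-introˡ (diaAt-plain future {f = λ v → tr σ v ψ} e h)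
    ⟐-plain past σ ψ u e h = ∨-introʳ (diaAt-plain past {f = λ v → tr σ v ψ} e h)

    ⟐-two-sided : L χ* → ∀ σ ψ u {v w κ κ′} →
                  (v , κ) ∈ edges future u → (w , κ′) ∈ edges past u →
                  L (tr σ v ψ) → L (tr σ w ψ) → L (tr σ u (⟐ ψ))
    ⟐-two-sided _ σ ψ u {κ = plain} eᶠ _ hᶠ _ = ⟐-plain future σ ψ u eᶠ hᶠ
    ⟐-two-sided _ σ ψ u {κ = modal} {κ′ = plain} _ eᵖ _ hᵖ = ⟐-plain past σ ψ u eᵖ hᵖ
    ⟐-two-sided χ*∈L σ ψ u {κ = modal} {κ′ = modal} eᶠ eᵖ hᶠ hᵖ =
      ∨-map (diaAt-modal future {f = λ v → tr σ v ψ} eᶠ hᶠ)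
            (diaAt-modal past {f = λ v → tr σ v ψ} eᵖ hᵖ)
            χ*∈L

    Log-χ* : L χ* → Log L χ*
    Log-χ* χ*∈L σ u u∈G with χ*-condition u∈G
    ... | plain-edge d e = ⟐-plain d σ ⊤' u e (⇒-refl ⊥')
    ... | two-sided eᶠ eᵖ = ⟐-two-sided χ*∈L σ ⊤' u eᶠ eᵖ (⇒-refl ⊥') (⇒-refl ⊥')

    boxAt-⟺ : ∀ {k} d u {f a} → Faithful (suc k) u → (∀ v → Faithful k v → f v ⟺ a) →
              boxAt d u f ⟺ box d a
    boxAt-⟺ d u {f} {a} faithful f⟺a with faithful d
    ... | (v , e) , neighbours =
      entails elim , entails (λ h → ⋀-intro (edges d u) (λ e′ → intro e′ h))
      where
      elim : Γ ⊢ boxAt d u f → Γ ⊢ box d a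
      elim h with neighbours e
      ... | _ , faithfulᵥ = theorem (□[]-mono d modal (proj₁ (f⟺a v faithfulᵥ))) · ⋀-elim e h
      intro : ∀ {v κ} → (v , κ) ∈ edges d u → Γ ⊢ box d a → Γ ⊢ □[ d ∣ κ ] f v
      intro {v = v} e′ h with neighbours e′
      ... | refl , faithfulᵥ = theorem (□[]-mono d modal (proj₂ (f⟺a v faithfulᵥ))) · h

    tr-canonical : ∀ k u φ → depth φ ≤ k → Faithful k u → tr canonical u φ ⟺ φ
    tr-canonical k u (var n) _ _ = ⇒-refl _ , ⇒-refl _
    tr-canonical k u ⊥' _ _ = ⇒-refl _ , ⇒-refl _
    tr-canonical k u (a ⇒ b) ≤k faithful =
      ⇒-cong (tr-canonical k u a (≤-trans (m≤m⊔n _ _) ≤k) faithful)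
             (tr-canonical k u b (≤-trans (m≤n⊔m (depth a) _) ≤k) faithful)
    tr-canonical (suc k) u (□ a) (s≤s ≤k) faithful =
      boxAt-⟺ future u faithful (λ v → tr-canonical k v a ≤k)
    tr-canonical (suc k) u (■ a) (s≤s ≤k) faithful =
      boxAt-⟺ past u faithful (λ v → tr-canonical k v a ≤k)

    Log-⊆-at-faithful : ∀ {u φ} → Node u → Faithful (depth φ) u → Log L φ → L φ
    Log-⊆-at-faithful {u} {φ} u∈G faithful φ∈Log =
      mp _ _ (proj₁ (tr-canonical (depth φ) u φ ≤-refl faithful)) (φ∈Log canonical u u∈G)

    ⟐ⁿ-refute : ∀ σ {ψ} → (∀ v → Node v → L (¬' (tr σ v ψ))) →
                ∀ k u → Node u → L (¬' (tr σ u (⟐ⁿ k ψ)))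
    ⟐ⁿ-refute σ h zero u u∈G = h u u∈G
    ⟐ⁿ-refute σ {ψ} h (suc k) u _ =
      ∨-refute (diaAt-refute future u (ih ∘ edge-target)) (diaAt-refute past u (ih ∘ edge-target))
      where
      ih : ∀ {v} → Node v → L (¬' (tr σ v (⟐ⁿ k ψ)))
      ih {v} v∈G = ⟐ⁿ-refute σ h k v v∈G

    ◇ⁿ⊤-at-loop : ∀ σ {u} → (u , plain) ∈ edges future u → ∀ m → L (tr σ u (◇ⁿ m ⊤'))
    ◇ⁿ⊤-at-loop σ loop zero = ⇒-refl ⊥'
    ◇ⁿ⊤-at-loop σ loop (suc m) =
      diaAt-plain future {f = λ v → tr σ v (◇ⁿ m ⊤')} loop (◇ⁿ⊤-at-loop σ loop m)

    ⟐ⁿ-at-loop : ∀ σ {u ψ} → (u , plain) ∈ edges future u → L (tr σ u ψ) →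
                 ∀ k → L (tr σ u (⟐ⁿ k ψ))
    ⟐ⁿ-at-loop σ loop h zero = h
    ⟐ⁿ-at-loop σ {u} {ψ} loop h (suc k) =
      ⟐-plain future σ (⟐ⁿ k ψ) u loop (⟐ⁿ-at-loop σ loop h k)

    π-at-loop : ∀ σ {u} → (u , plain) ∈ edges future u → ∀ k m → L (tr σ u (π k m))
    π-at-loop σ loop k m = ⟐ⁿ-at-loop σ loop (◇ⁿ⊤-at-loop σ loop m) k

  Log-NExt : ∀ {L} → NExt⊕ χ* L → NExt⊕ χ* (Log L)
  Log-NExt (NT , χ*∈L) = Log-normal NT , Log-χ* NT χ*∈L

-- A ray with loops, on which π holds

module Ray (K : ℕ) where
  loop : ℕ → List Edge
  loop j with K ≤? j
  ... | yes _ = (j , plain) ∷ []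
  ... | no _ = []

  adjacent : ℕ → List Edge
  adjacent zero = (1 , modal) ∷ (0 , plain) ∷ []
  adjacent (suc i) = (suc (suc i) , modal) ∷ (i , modal) ∷ loop (suc i)

  ∈-loop : ∀ {j v κ} → (v , κ) ∈ loop j → v ≡ j × κ ≡ plain × K ≤ j
  ∈-loop {j} e with K ≤? j
  ∈-loop (here refl) | yes K≤j = refl , refl , K≤j
  ∈-loop (there ()) | yes _

  loop-∈ : ∀ {j} → K ≤ j → (j , plain) ∈ loop j
  loop-∈ {j} K≤j with K ≤? j
  ... | yes _ = here refl
  ... | no K≰j = ⊥-elim (K≰j K≤j)

  next-∈ : ∀ j → (suc j , modal) ∈ adjacent j
  next-∈ zero = here refl
  next-∈ (suc i) = here refl

  previous-∈ : ∀ i → (i , modal) ∈ adjacent (suc i)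
  previous-∈ i = there (here refl)

  origin-looped : (0 , plain) ∈ adjacent 0
  origin-looped = there (here refl)

  looped : ∀ {j} → K ≤ j → (j , plain) ∈ adjacent j
  looped {zero} _ = origin-looped
  looped {suc i} K≤j = there (there (loop-∈ K≤j))

  adjacent-sym : ∀ {u v κ} → (v , κ) ∈ adjacent u → (u , κ) ∈ adjacent v
  adjacent-sym {zero} (here refl) = previous-∈ 0
  adjacent-sym {zero} (there (here refl)) = origin-looped
  adjacent-sym {suc i} (here refl) = previous-∈ (suc i)
  adjacent-sym {suc zero} (there (here refl)) = next-∈ 0
  adjacent-sym {suc (suc i)} (there (here refl)) = next-∈ (suc i)
  adjacent-sym {suc i} (there (there e)) with ∈-loop e
  ... | refl , refl , _ = there (there e)

  ray : Graph
  ray = record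
    { Node = λ _ → ⊤
    ; edges = λ _ → adjacent
    ; edge-target = λ _ → tt
    ; edge-reverse = adjacent-sym
    ; χ*-condition = λ {u} _ → two-sided (next-∈ u) (next-∈ u)
    }

  open GraphLogic ray

  ray-faithful : ∀ k j → k ≤ j → j + k ≤ K → Faithful k j
  ray-faithful zero j _ _ = tt
  ray-faithful (suc k) (suc i) (s≤s k≤i) j+1+k≤K _ = (_ , next-∈ (suc i)) , neighbours
    where
    j+1+k≤K′ : suc (suc i) + k ≤ K
    j+1+k≤K′ = subst (_≤ K) (+-suc (suc i) k) j+1+k≤K
    neighbours : ∀ {v κ} → (v , κ) ∈ adjacent (suc i) → κ ≡ modal × Faithful k v
    neighbours (here refl) =
      refl , ray-faithful k (suc (suc i)) (m≤n⇒m≤1+n (m≤n⇒m≤1+n k≤i)) j+1+k≤K′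
    neighbours (there (here refl)) =
      refl , ray-faithful k i k≤i (≤-trans (m≤n⇒m≤1+n (n≤1+n (i + k))) j+1+k≤K′)
    neighbours (there (there e)) =
      ⊥-elim (<⇒≱ (m+n≤o⇒m≤o (suc (suc i)) j+1+k≤K′) (proj₂ (proj₂ (∈-loop e))))

  Log-ray-⊆ : ∀ {L φ} → NormalTense L → depth φ + depth φ ≤ K → Log L φ → L φ
  Log-ray-⊆ NT 2depth≤K = Log-⊆-at-faithful NT tt (ray-faithful _ _ ≤-refl 2depth≤K)

  module _ {L : Logic} (NT : NormalTense L) (χ*∈L : L χ*) (σ : ℕ → ℕ → Fm) (m : ℕ) where
    π-near-origin : ∀ j k → j ≤ k → L (tr σ j (π k m))
    π-near-origin zero k _ = π-at-loop NT σ origin-looped k m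
    π-near-origin (suc i) (suc k) (s≤s i≤k) =
      ⟐-two-sided NT χ*∈L σ (π k m) (suc i) (previous-∈ i) (previous-∈ i) ih ih
      where
      ih : L (tr σ i (π k m))
      ih = π-near-origin i k i≤k

    π-near-loops : ∀ j k → K ≤ j + k → L (tr σ j (π k m))
    π-near-loops j zero K≤j+0 = π-at-loop NT σ (looped (subst (K ≤_) (+-identityʳ j) K≤j+0)) 0 m
    π-near-loops j (suc k) K≤j+1+k = ⟐-two-sided NT χ*∈L σ (π k m) j (next-∈ j) (next-∈ j) ih ih
      where
      ih : L (tr σ (suc j) (π k m))
      ih = π-near-loops (suc j) k (subst (K ≤_) (+-suc j k) K≤j+1+k)

  π∈Log : ∀ {L} → NExt⊕ χ* L → ∀ k → K ≤ k + k → ∀ m → Log L (π k m)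
  π∈Log (NT , χ*∈L) k K≤k+k m σ u _ with u ≤? k
  ... | yes u≤k = π-near-origin NT χ*∈L σ m u k u≤k
  ... | no u≰k = π-near-loops NT χ*∈L σ m u k (≤-trans K≤k+k (+-monoˡ-≤ k (<⇒≤ (≰⇒> u≰k))))

-- A finite path, on which π is refuted

modalsThenPlain : ℕ → ℕ → Maybe Kind
modalsThenPlain zero zero = just plain
modalsThenPlain zero (suc _) = nothing
modalsThenPlain (suc n) zero = just modal
modalsThenPlain (suc n) (suc i) = modalsThenPlain n i

modalsThenPlain-modal : ∀ {n i} → i < n → modalsThenPlain n i ≡ just modal
modalsThenPlain-modal {suc n} {zero} _ = refl
modalsThenPlain-modal {suc n} {suc i} (s≤s i<n) = modalsThenPlain-modal i<n

modalsThenPlain-last : ∀ n → modalsThenPlain n n ≡ just plain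
modalsThenPlain-last zero = refl
modalsThenPlain-last (suc n) = modalsThenPlain-last n

modalsThenPlain-defined : ∀ {n i} → i ≤ n → ∃[ κ ] modalsThenPlain n i ≡ just κ
modalsThenPlain-defined {n} i≤n with m≤n⇒m<n∨m≡n i≤n
... | inj₁ i<n = modal , modalsThenPlain-modal i<n
... | inj₂ refl = plain , modalsThenPlain-last n

modalsThenPlain-bound : ∀ {n i κ} → modalsThenPlain n i ≡ just κ → i ≤ n
modalsThenPlain-bound {zero} {zero} _ = z≤n
modalsThenPlain-bound {suc n} {zero} _ = z≤n
modalsThenPlain-bound {suc n} {suc i} eq = s≤s (modalsThenPlain-bound eq)

edgeTo : ℕ → Maybe Kind → List Edge
edgeTo v nothing = []
edgeTo v (just κ) = (v , κ) ∷ []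

∈-edgeTo : ∀ {v w κ mκ} → (w , κ) ∈ edgeTo v mκ → w ≡ v × mκ ≡ just κ
∈-edgeTo {mκ = just _} (here refl) = refl , refl

∈-edgeTo-just : ∀ {v w κ κ′ mκ} → mκ ≡ just κ′ → (w , κ) ∈ edgeTo v mκ → w ≡ v × κ ≡ κ′
∈-edgeTo-just refl (here refl) = refl , refl

edgeTo-∈ : ∀ {v κ mκ} → mκ ≡ just κ → (v , κ) ∈ edgeTo v mκ
edgeTo-∈ refl = here refl

module Path (n : ℕ) where
  N : ℕ
  N = suc (suc n)

  kindAt : ℕ → Maybe Kind
  kindAt zero = just plain
  kindAt (suc j) = modalsThenPlain n j

  kindAt-bound : ∀ {j κ} → kindAt j ≡ just κ → j ≤ suc n
  kindAt-bound {zero} _ = z≤n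
  kindAt-bound {suc j} eq = s≤s (modalsThenPlain-bound eq)

  kindAt-defined : ∀ {j} → j ≤ suc n → ∃[ κ ] kindAt j ≡ just κ
  kindAt-defined {zero} _ = plain , refl
  kindAt-defined {suc j} (s≤s j≤n) = modalsThenPlain-defined j≤n

  path-edges : Dir → ℕ → List Edge
  path-edges future j = edgeTo (suc j) (kindAt j)
  path-edges past zero = []
  path-edges past (suc j) = edgeTo j (kindAt j)

  path-target : ∀ {d u v κ} → (v , κ) ∈ path-edges d u → v ≤ N
  path-target {future} e with ∈-edgeTo e
  ... | refl , eq = s≤s (kindAt-bound eq)
  path-target {past} {suc u} e with ∈-edgeTo e
  ... | refl , eq = m≤n⇒m≤1+n (kindAt-bound eq)

  path-reverse : ∀ {d u v κ} → (v , κ) ∈ path-edges d u → (u , κ) ∈ path-edges (opposite d) v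
  path-reverse {future} e with ∈-edgeTo e
  ... | refl , eq = edgeTo-∈ eq
  path-reverse {past} {suc u} e with ∈-edgeTo e
  ... | refl , eq = edgeTo-∈ eq

  path-χ* : ∀ {u} → u ≤ N → χ*-Condition path-edges u
  path-χ* {zero} _ = plain-edge future (here refl)
  path-χ* {suc j} 1+j≤N with m≤n⇒m<n∨m≡n 1+j≤N
  ... | inj₁ (s≤s 1+j≤1+n) =
    two-sided (edgeTo-∈ (proj₂ (kindAt-defined 1+j≤1+n)))
              (edgeTo-∈ (proj₂ (kindAt-defined (≤-trans (n≤1+n j) 1+j≤1+n))))
  ... | inj₂ refl = plain-edge past (edgeTo-∈ (modalsThenPlain-last n))

  path : Graph
  path = record
    { Node = _≤ N
    ; edges = path-edges
    ; edge-target = λ {d} → path-target {d}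
    ; edge-reverse = λ {d} → path-reverse {d}
    ; χ*-condition = path-χ*
    }

  open GraphLogic path

  path-faithful : ∀ k j → k < j → j + k ≤ suc n → Faithful k j
  path-faithful zero j _ _ = tt
  path-faithful (suc k) (suc (suc i)) (s≤s (s≤s k≤i)) j+1+k≤1+n = faithful
    where
    j+k≤n : suc (suc i) + k ≤ n
    j+k≤n = s≤s⁻¹ (subst (_≤ suc n) (+-suc (suc (suc i)) k) j+1+k≤1+n)
    out-modal : kindAt (suc (suc i)) ≡ just modal
    out-modal = modalsThenPlain-modal (m+n≤o⇒m≤o (suc (suc i)) j+k≤n)
    in-modal : kindAt (suc i) ≡ just modal
    in-modal = modalsThenPlain-modal (≤-trans (n≤1+n (suc i)) (m+n≤o⇒m≤o (suc (suc i)) j+k≤n))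
    forward : ∀ {v κ} → (v , κ) ∈ path-edges future (suc (suc i)) → κ ≡ modal × Faithful k v
    forward e with ∈-edgeTo-just out-modal e
    ... | refl , refl =
      refl , path-faithful k (suc (suc (suc i))) (s≤s (m≤n⇒m≤1+n (m≤n⇒m≤1+n k≤i))) (s≤s j+k≤n)
    backward : ∀ {v κ} → (v , κ) ∈ path-edges past (suc (suc i)) → κ ≡ modal × Faithful k v
    backward e with ∈-edgeTo-just in-modal e
    ... | refl , refl =
      refl , path-faithful k (suc i) (s≤s k≤i) (m≤n⇒m≤1+n (≤-trans (n≤1+n _) j+k≤n))
    faithful : Faithful (suc k) (suc (suc i))
    faithful future = (_ , edgeTo-∈ out-modal) , forward
    faithful past = (_ , edgeTo-∈ in-modal) , backward

  Log-path-⊆ : ∀ {L φ} → NormalTense L → depth φ + depth φ ≤ n → Log L φ → L φ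
  Log-path-⊆ NT 2depth≤n = Log-⊆-at-faithful NT
    (s≤s (m≤n⇒m≤1+n (≤-trans (m≤m+n _ _) 2depth≤n))) (path-faithful _ _ ≤-refl (s≤s 2depth≤n))

  module _ {L : Logic} (NT : NormalTense L) (σ : ℕ → ℕ → Fm) where
    ◇ⁿ⊤-refute : ∀ m j → j ≤ N → N < j + m → L (¬' (tr σ j (◇ⁿ m ⊤')))
    ◇ⁿ⊤-refute zero j j≤N N<j+0 = ⊥-elim (≤⇒≯ j≤N (subst (N <_) (+-identityʳ j) N<j+0))
    ◇ⁿ⊤-refute (suc m) j _ N<j+1+m = diaAt-refute NT future j refute-next
      where
      refute-next : ∀ {v κ} → (v , κ) ∈ path-edges future j → L (¬' (tr σ v (◇ⁿ m ⊤')))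
      refute-next e with ∈-edgeTo e
      ... | refl , eq =
        ◇ⁿ⊤-refute m (suc j) (s≤s (kindAt-bound eq)) (subst (N <_) (+-suc j m) N<j+1+m)

  ¬π∈Log : ∀ {L} → NormalTense L → ∀ k → Log L (¬' (π k (suc N)))
  ¬π∈Log NT k σ =
    ⟐ⁿ-refute NT σ (λ v v≤N → ◇ⁿ⊤-refute NT σ (suc N) v v≤N (m≤n+m (suc N) v)) k

open GraphLogic using (Log; Log-NExt)

companion-⊆ : ∀ {L₁ L₂} → NExt⊕ χ* L₁ → (∀ L → NExt⊕ χ* L → (L ⊆ L₁) ⊎ (L₂ ⊆ L)) → L₂ ⊆ L₁
companion-⊆ {L₁} {L₂} L₁∈NExt@(L₁-normal , _) dichotomy φ φ∈L₂ =
  conclude (dichotomy (Log path L₁) (Log-NExt path L₁∈NExt))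
           (dichotomy (Log ray L₁) (Log-NExt ray L₁∈NExt))
  where
  d : ℕ
  d = depth φ
  open Path (d + d) using (path; Log-path-⊆; ¬π∈Log)
  open Ray (d + d) using (ray; Log-ray-⊆; π∈Log)
  separator : Fm
  separator = π d (3 + (d + d))
  conclude : (Log path L₁ ⊆ L₁) ⊎ (L₂ ⊆ Log path L₁) → (Log ray L₁ ⊆ L₁) ⊎ (L₂ ⊆ Log ray L₁) →
             L₁ φ
  conclude (inj₂ L₂⊆path) _ = Log-path-⊆ L₁-normal ≤-refl (L₂⊆path φ φ∈L₂)
  conclude (inj₁ _) (inj₂ L₂⊆ray) = Log-ray-⊆ L₁-normal ≤-refl (L₂⊆ray φ φ∈L₂)
  conclude (inj₁ path⊆L₁) (inj₁ ray⊆L₁) =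
    Hilbert.explode L₁-normal (path⊆L₁ (¬' separator) (¬π∈Log L₁-normal d))
                              (ray⊆L₁ separator (π∈Log L₁∈NExt d ≤-refl (3 + (d + d))))

mainTheorem6 : ∀ (L₁ : Logic) → ¬ Splits χ* L₁
mainTheorem6 L₁ (L₁∈NExt , L₂ , L₂∈NExt , splitting) =
  proj₂ (splitting L₂ L₂∈NExt) (L₂⊆L₁ , λ _ φ∈L₂ → φ∈L₂)
  where
  L₂⊆L₁ : L₂ ⊆ L₁
  L₂⊆L₁ = companion-⊆ L₁∈NExt (λ L L∈NExt → proj₁ (splitting L L∈NExt))
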